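{- Let $T_6$ be the caterpillar tree on the leaf set $\{1,2,3,4,5,6\}$, i.e. the binary phylogenetic tree consisting of a path $v_1v_2v_3v_4$ of interior vertices, with leaves $1,2$ adjacent to $v_1$, leaf $3$ adjacent to $v_2$, leaf $4$ adjacent to $v_3$, and leaves $5,6$ adjacent to $v_4$. Then the set of quartets $$Q_6=\{12|35,\ 13|46,\ 12|56,\ 24|56\}$$ is a minimal definitive quartet set for $T_6$; that is, $T_6$ is the unique phylogenetic tree with leaf set $\{1,\dots,6\}$ displaying $Q_6$, but for every $q\in Q_6$ the set $Q_6-q$ does not define $T_6$.
   Context: A phylogenetic tree is a (finite) tree with no vertices of degree $2$ whose leaves are distinctly labelled and whose interior vertices are unlabelled; it is binary if every interior vertex has degree exactly $3$. A quartet is a binary phylogenetic tree with exactly four leaves; $uv|wx$ denotes the quartet in which the path from $u$ to $v$ is disjoint from the path from $w$ to $x$. A phylogenetic tree $T$ displays the quartet $uv|wx$ if $u,v,w,x$ are leaves of $T$ and the path in $T$ from $u$ to $v$ does not intersect the path from $w$ to $x$; $T$ displays a set of quartets $Q$ if it displays each quartet in $Q$. For a set of quartets $Q$ with total leaf set $L(Q)$ (the union of the leaf sets of its quartets), $Q$ defines $T$ (is definitive for $T$) if $T$ is the unique phylogenetic tree (up to label-preserving isomorphism) with leaf set $L(Q)$ that displays $Q$. $Q$ is minimally definitive (for $T$) if $Q$ defines $T$ but for every $q\in Q$, $Q-q$ does not define $T$. -}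

module Defs where

open import Data.Nat using (ℕ; zero; suc; _+_; _≥_)
open import Data.Fin using (Fin; zero; suc)
open import Data.Fin.Properties using (_≟_)
open import Data.Bool using (Bool; true; false; if_then_else_)
open import Data.List using (List; []; _∷_; length; map; allFin; removeAt)
open import Data.Nat.ListAction using (sum)
open import Data.List.Membership.Propositional using (_∈_)
open import Data.List.Relation.Unary.Any using (Any)
open import Data.List.Relation.Unary.Unique.Propositional using (Unique)
open import Data.List.Relation.Unary.All using (All)
open import Data.Product using (Σ; ∃; _×_; _,_)
open import Data.Empty using (⊥)
open import Relation.Nullary using (¬_; yes; no)
open import Relation.Nullary.Decidable using (True; toWitness)
open import Relation.Binary.PropositionalEquality using (_≡_)
import Data.List.Relation.Unary.Unique.DecPropositional as UD

-- Leaf labels.  The leaf set {1,...,6} is represented by Fin 6, where the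
-- label i (1 ≤ i ≤ 6) is the element of Fin 6 with value i - 1.

Label : Set
Label = Fin 6

record LabelledGraph : Set where
  field
    n    : ℕ
    adj  : Fin n → Fin n → Bool
    leaf : Label → Fin n
open LabelledGraph public

module _ {m : ℕ} (adj : Fin m → Fin m → Bool) where

  data Walk : Fin m → Fin m → List (Fin m) → Set where
    here : ∀ {a} → Walk a a (a ∷ [])
    step : ∀ {a b c xs} → adj a b ≡ true → Walk b c xs → Walk a c (a ∷ xs)

  IsPath : Fin m → Fin m → List (Fin m) → Set
  IsPath a b xs = Walk a b xs × Unique xs

  IsCycle : List (Fin m) → Set
  IsCycle xs = Σ (Fin m) λ a → Σ (Fin m) λ b →
    IsPath a b xs × length xs ≥ 3 × adj b a ≡ true

  Connected : Set
  Connected = ∀ a b → ∃ λ xs → IsPath a b xs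

  Acyclic : Set
  Acyclic = ∀ xs → ¬ IsCycle xs

  IsTree : Set
  IsTree = (∀ a → adj a a ≡ false) × (∀ a b → adj a b ≡ adj b a)
         × Connected × Acyclic

  degree : Fin m → ℕ
  degree v = sum (map (λ w → if adj v w then 1 else 0) (allFin m))

IsPhyloTree : LabelledGraph → Set
IsPhyloTree G =
  IsTree (adj G)
  × (∀ x y → leaf G x ≡ leaf G y → x ≡ y)
  × (∀ x → degree (adj G) (leaf G x) ≡ 1)
  × (∀ v → degree (adj G) v ≡ 1 → ∃ λ x → leaf G x ≡ v)
  × (∀ v → ¬ degree (adj G) v ≡ 2)

record Iso (G H : LabelledGraph) : Set where
  field
    to      : Fin (n G) → Fin (n H)
    from    : Fin (n H) → Fin (n G)
    from-to : ∀ v → from (to v) ≡ v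
    to-from : ∀ w → to (from w) ≡ w
    adj-pres : ∀ u v → adj H (to u) (to v) ≡ adj G u v
    leaf-pres : ∀ x → to (leaf G x) ≡ leaf H x

record Quartet : Set where
  constructor quartet
  field
    a b c d  : Label
    distinct : Unique (a ∷ b ∷ c ∷ d ∷ [])
open Quartet public

_∣q_ : (ab cd : Label × Label) →
       let (a , b) = ab ; (c , d) = cd in
       {True (UD.unique? _≟_ (a ∷ b ∷ c ∷ d ∷ []))} → Quartet
_∣q_ (a , b) (c , d) {p} = quartet a b c d (toWitness p)

qLabels : Quartet → List Label
qLabels q = a q ∷ b q ∷ c q ∷ d q ∷ []

DisplaysQ : LabelledGraph → Quartet → Set
DisplaysQ G q =
  ∀ xs ys → IsPath (adj G) (leaf G (a q)) (leaf G (b q)) xs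
          → IsPath (adj G) (leaf G (c q)) (leaf G (d q)) ys
          → ∀ v → v ∈ xs → v ∈ ys → ⊥

Displays : LabelledGraph → List Quartet → Set
Displays G Q = All (DisplaysQ G) Q

CoversLabels : List Quartet → Set
CoversLabels Q = ∀ x → Any (λ q → x ∈ qLabels q) Q

Defines : List Quartet → LabelledGraph → Set
Defines Q T =
  CoversLabels Q × IsPhyloTree T × Displays T Q
  × (∀ T' → IsPhyloTree T' → Displays T' Q → Iso T' T)

MinimallyDefinitive : List Quartet → LabelledGraph → Set
MinimallyDefinitive Q T =
  Defines Q T × (∀ (i : Fin (length Q)) → ¬ Defines (removeAt Q i) T)

-- The caterpillar T6.  Vertices: Fin 10; vertex k (k < 6) is the leaf
-- with label k+1; vertices 6,7,8,9 are v1,v2,v3,v4.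

l1 l2 l3 l4 l5 l6 : Label
l1 = zero
l2 = suc zero
l3 = suc (suc zero)
l4 = suc (suc (suc zero))
l5 = suc (suc (suc (suc zero)))
l6 = suc (suc (suc (suc (suc zero))))

T6-edges : List (ℕ × ℕ)
T6-edges = (0 , 6) ∷ (1 , 6) ∷ (2 , 7) ∷ (3 , 8) ∷ (4 , 9) ∷ (5 , 9)
         ∷ (6 , 7) ∷ (7 , 8) ∷ (8 , 9) ∷ []

private
  eqℕ : ℕ → ℕ → Bool
  eqℕ zero zero = true
  eqℕ (suc x) (suc y) = eqℕ x y
  eqℕ _ _ = false

  orB : Bool → Bool → Bool
  orB true _ = true
  orB false b = b

  edgeB : ℕ → ℕ → List (ℕ × ℕ) → Bool
  edgeB u v [] = false
  edgeB u v ((x , y) ∷ es) =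
    orB (orB (if eqℕ u x then eqℕ v y else false)
             (if eqℕ u y then eqℕ v x else false))
        (edgeB u v es)

T6 : LabelledGraph
T6 = record
  { n    = 10
  ; adj  = λ u v → edgeB (Data.Fin.toℕ u) (Data.Fin.toℕ v) T6-edges
  ; leaf = λ x → x Data.Fin.↑ˡ 4
  }
  where import Data.Fin

Q6 : List Quartet
Q6 = ((l1 , l2) ∣q (l3 , l5))
   ∷ ((l1 , l3) ∣q (l4 , l6))
   ∷ ((l1 , l2) ∣q (l5 , l6))
   ∷ ((l2 , l4) ∣q (l5 , l6))
   ∷ []

module Submission where

-- Uniqueness: the branch of an internal vertex u towards a label z is the
-- neighbour of u on the path to leaf z.  A displayed quartet ab|cd puts c, d in
-- one branch whenever a, b lie in different branches.  As u has at least three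
-- branches, a label alone in its branch is a leaf hanging at u ('peel').  From
-- the neighbour of leaf 1 the quartets let us peel off 2, 3, 4 and then 5, 6
-- along the spine; the resulting embedding of T6 is onto every neighbourhood,
-- hence an isomorphism ('Recognition').  Minimality: for each q an explicit tree
-- displays Q6 - q but has a cherry that T6 lacks; such finite facts are decided
-- by computation ('Concrete', acyclicity by exhaustive search of simple paths).

open import Defs

open import Function using (_∘_)
open import Data.Nat as ℕ using (ℕ; zero; suc; _+_; _≤_; _<_; z≤n; s≤s; _≡ᵇ_)
open import Data.Nat.Properties using (≤-trans; ≤-antisym; ≤-reflexive; m≤n+m; ≰⇒>; m<n+m; <⇒≱; +-identityʳ; +-suc)
open import Data.Nat.ListAction using (sum)
open import Data.Fin as Fin using (Fin; zero; suc; toℕ; splitAt; join; _↑ˡ_)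
open import Data.Fin.Properties using (_≟_; any?; all?; pigeonhole; splitAt-↑ˡ; join-splitAt)
open import Data.Bool using (Bool; true; false; T; if_then_else_; _∧_; _∨_)
import Data.Bool.Properties as Bool
open import Data.Bool.ListAction using (any)
open import Data.Maybe using (Maybe; just; nothing; is-just; maybe)
open import Data.List using (List; []; _∷_; _++_; length; reverse; map; filter; allFin; lookup; removeAt)
open import Data.List.Properties using (unfold-reverse; reverse-++)
open import Data.List.Membership.Propositional using (_∈_; _∉_; find)
open import Data.List.Membership.Propositional.Properties
  using (∈-++⁺ˡ; ∈-allFin; ∈-lookup; ∈-filter⁺; ∈-filter⁻)
import Data.List.Membership.DecPropositional as DecMembership
open import Data.List.Relation.Unary.Any using (Any; here; there; satisfied)
import Data.List.Relation.Unary.Any as Any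
import Data.List.Relation.Unary.Any.Properties as AnyProps
open import Data.List.Relation.Unary.All using (All; []; _∷_)
import Data.List.Relation.Unary.All as All
open import Data.List.Relation.Unary.All.Properties.Core using (¬Any⇒All¬)
open import Data.List.Relation.Unary.AllPairs using ([]; _∷_)
import Data.List.Relation.Unary.AllPairs as AllPairs
open import Data.List.Relation.Unary.Unique.Propositional using (Unique)
open import Data.List.Relation.Unary.Unique.Propositional.Properties using (Unique[x∷xs]⇒x∉xs; ++⁺; allFin⁺)
import Data.List.Relation.Unary.Unique.DecPropositional as DecUnique
open import Data.List.Relation.Binary.Disjoint.Propositional using (Disjoint)
import Data.List.Relation.Binary.Disjoint.DecPropositional as DecDisjoint
import Data.List.Relation.Binary.Permutation.Setoid as Perm
import Data.List.Relation.Binary.Permutation.Setoid.Properties as Perm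
open import Data.Product using (Σ; ∃; _×_; _,_; proj₁; proj₂)
open import Data.Sum using (_⊎_; inj₁; inj₂; [_,_]′)
import Data.Sum as Sum
open import Data.Unit using (⊤; tt)
open import Data.Empty using (⊥; ⊥-elim)
open import Relation.Nullary using (¬_; Dec; yes; no; does)
open import Relation.Nullary.Decidable using (True; False; toWitness; toWitnessFalse; T?; ¬?; _×-dec_; _→-dec_)
open import Relation.Binary.PropositionalEquality using (_≡_; _≢_; refl; sym; trans; cong; cong₂; subst; module ≡-Reasoning)
open import Relation.Binary.PropositionalEquality.Properties using (setoid)

module _ {A : Set} where

  unique-cons : ∀ {x : A} {xs} → x ∉ xs → Unique xs → Unique (x ∷ xs)
  unique-cons {xs = xs} x∉xs u = ¬Any⇒All¬ xs x∉xs ∷ u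

  unique-prefix : ∀ (xs : List A) {ys} → Unique (xs ++ ys) → Unique xs
  unique-prefix []       _       = []
  unique-prefix (x ∷ xs) (h ∷ u) =
    unique-cons (λ m → Unique[x∷xs]⇒x∉xs (h ∷ u) (∈-++⁺ˡ m)) (unique-prefix xs u)

  unique-reverse : ∀ (xs : List A) → Unique xs → Unique (reverse xs)
  unique-reverse xs =
    Perm.Unique-resp-↭ (setoid A) (Perm.↭-sym (setoid A) (Perm.↭-reverse (setoid A) xs))

unique-length : ∀ {m} (xs : List (Fin m)) → Unique xs → length xs ≤ m
unique-length {m} xs u with length xs ℕ.≤? m
... | yes ≤m = ≤m
... | no  >m with pigeonhole (≰⇒> >m) (lookup xs)
...   | i , j , i<j , same = ⊥-elim (distinct-entries xs u i j i<j same)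
  where
  distinct-entries : ∀ (xs : List (Fin m)) → Unique xs → ∀ i j → i Fin.< j →
                     lookup xs i ≢ lookup xs j
  distinct-entries (x ∷ xs) u zero (suc j) _ eq =
    Unique[x∷xs]⇒x∉xs u (subst (_∈ xs) (sym eq) (∈-lookup j))
  distinct-entries (x ∷ xs) u (suc i) (suc j) (s≤s i<j) eq =
    distinct-entries xs (AllPairs.tail u) i j i<j eq

module Walks {m : ℕ} (A : Fin m → Fin m → Bool) where

  walk-start : ∀ {a b xs} → Walk A a b xs → a ∈ xs
  walk-start here       = here refl
  walk-start (step _ _) = here refl

  walk-end : ∀ {a b xs} → Walk A a b xs → b ∈ xs
  walk-end here       = here refl
  walk-end (step _ w) = there (walk-end w)

  walk-from : ∀ {a b xs} → Walk A a b xs → Σ (List (Fin m)) λ r → xs ≡ a ∷ r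
  walk-from here       = _ , refl
  walk-from (step _ _) = _ , refl

  walk-uncons : ∀ {a c w xs} → Walk A a c (a ∷ w ∷ xs) → A a w ≡ true × Walk A w c (w ∷ xs)
  walk-uncons (step e here)        = e , here
  walk-uncons (step e (step e′ w)) = e , step e′ w

  walk-first-edge : ∀ {a c ys} → Walk A a c ys → a ≢ c →
                    Σ (Fin m) λ y → Σ (List (Fin m)) λ rest →
                      ys ≡ a ∷ y ∷ rest × A a y ≡ true × Walk A y c (y ∷ rest)
  walk-first-edge here                 a≢c = ⊥-elim (a≢c refl)
  walk-first-edge (step e here)        _   = _ , [] , refl , e , here
  walk-first-edge (step e (step e′ w)) _   = _ , _ , refl , e , step e′ w

  walk-++ : ∀ {a b c xs ys} → Walk A a b xs → Walk A b c (b ∷ ys) → Walk A a c (xs ++ ys)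
  walk-++ here       w′ = w′
  walk-++ (step e w) w′ = step e (walk-++ w w′)

  walk-reverse : (∀ a b → A a b ≡ A b a) → ∀ {a b xs} → Walk A a b xs → Walk A b a (reverse xs)
  walk-reverse sym-A here = here
  walk-reverse sym-A {a} (step {xs = xs} e w) rewrite unfold-reverse a xs =
    walk-++ (walk-reverse sym-A w) (step (trans (sym-A _ _) e) here)

  walk-prefix : ∀ {a b c xs} → Walk A a b xs → c ∈ xs →
                Σ (List (Fin m)) λ ys → Σ (List (Fin m)) λ zs → Walk A a c ys × xs ≡ ys ++ zs
  walk-prefix here                 (here refl) = _ ∷ [] , [] , here , refl
  walk-prefix (step {xs = xs} e w) (here refl) = _ ∷ [] , xs , here , refl
  walk-prefix (step e w)           (there c∈)  with walk-prefix w c∈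
  ... | ys , zs , w′ , eq = _ ∷ ys , zs , step e w′ , cong (_ ∷_) eq

  path-prefix : ∀ {a b c xs} → IsPath A a b xs → c ∈ xs →
                Σ (List (Fin m)) λ ys → IsPath A a c ys × (∀ {v} → v ∈ ys → v ∈ xs)
  path-prefix (w , u) c∈ with walk-prefix w c∈
  ... | ys , zs , w′ , refl = ys , (w′ , unique-prefix ys u) , ∈-++⁺ˡ

module Forest {m : ℕ} (A : Fin m → Fin m → Bool)
              (irrefl : ∀ a → A a a ≡ false) (symm : ∀ a b → A a b ≡ A b a)
              (acyclic : Acyclic A) where

  open Walks A

  adjacent-distinct : ∀ {a b} → A a b ≡ true → a ≢ b
  adjacent-distinct {a} e refl with trans (sym e) (irrefl a)
  ... | ()

  adjacent-sym : ∀ {a b} → A a b ≡ true → A b a ≡ true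
  adjacent-sym {a} {b} e = trans (symm b a) e

  -- If a has distinct neighbours p and r, a path leaving p that avoids a
  -- never visits r: otherwise a, p, ..., r, a would be a cycle.
  no-shortcut : ∀ {a p r b P} → A a p ≡ true → A a r ≡ true → p ≢ r →
                IsPath A p b P → a ∉ P → r ∉ P
  no-shortcut {a} {r = r} a~p a~r p≢r (w , u) a∉P r∈P with path-prefix (w , u) r∈P
  ... | ys , (w′ , u′) , ys⊆P with walk-first-edge w′ p≢r
  ... | _ , _ , refl , _ , _ =
    acyclic (a ∷ ys) (a , r , (step a~p w′ , unique-cons (λ a∈ys → a∉P (ys⊆P a∈ys)) u′) ,
                      s≤s (s≤s (s≤s z≤n)) , adjacent-sym a~r)

  -- By induction on the second path: if r
  -- lies on the first one we have a shortcut, otherwise we move a to r.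
  no-two-routes : ∀ {a p r b P R} → p ≢ r → A a p ≡ true → A a r ≡ true →
                  IsPath A p b P → a ∉ P → IsPath A r b R → a ∉ R → ⊥
  no-two-routes p≢r a~p a~r πP a∉P (here , _) _ =
    no-shortcut a~p a~r p≢r πP a∉P (walk-end (proj₁ πP))
  no-two-routes {a} {r = r} {P = P} p≢r a~p a~r πP a∉P (step {b = r′} e w , u) a∉R
    with DecMembership._∈?_ _≟_ r P
  ... | yes r∈P = no-shortcut a~p a~r p≢r πP a∉P r∈P
  ... | no  r∉P =
    no-two-routes {a = r} {p = a} {r = r′} a≢r′ (adjacent-sym a~r) e
      (step a~p (proj₁ πP) , unique-cons a∉P (proj₂ πP)) r∉aP
      (w , AllPairs.tail u) (Unique[x∷xs]⇒x∉xs u)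
    where
    a≢r′ : a ≢ r′
    a≢r′ refl = a∉R (there (walk-start w))
    r∉aP : r ∉ a ∷ P
    r∉aP (here r≡a) = adjacent-distinct a~r (sym r≡a)
    r∉aP (there r∈P) = r∉P r∈P

  path-unique : ∀ {a b P R} → IsPath A a b P → IsPath A a b R → P ≡ R
  path-unique (here , _) (here , _) = refl
  path-unique (here , _) (step _ w , u) = ⊥-elim (Unique[x∷xs]⇒x∉xs u (walk-end w))
  path-unique (step _ w , u) (here , _) = ⊥-elim (Unique[x∷xs]⇒x∉xs u (walk-end w))
  path-unique (step {b = p} e w , u) (step {b = r} e′ w′ , u′) with p ≟ r
  ... | yes refl = cong (_ ∷_) (path-unique (w , AllPairs.tail u) (w′ , AllPairs.tail u′))
  ... | no  p≢r  = ⊥-elim (no-two-routes p≢r e e′ (w , AllPairs.tail u) (Unique[x∷xs]⇒x∉xs u)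
                                                  (w′ , AllPairs.tail u′) (Unique[x∷xs]⇒x∉xs u′))

module Degree {m : ℕ} (A : Fin m → Fin m → Bool) (v : Fin m) where

  edge-count : List (Fin m) → ℕ
  edge-count l = sum (map (λ w → if A v w then 1 else 0) l)

  count-none : ∀ l → (∀ {w} → w ∈ l → A v w ≡ false) → edge-count l ≡ 0
  count-none []      _    = refl
  count-none (x ∷ l) none rewrite none (here refl) = count-none l (none ∘ there)

  count-≤1 : ∀ {p} l → Unique l → (∀ {w} → w ∈ l → A v w ≡ true → w ≡ p) → edge-count l ≤ 1
  count-≤1 []      _ _ = z≤n
  count-≤1 (x ∷ l) u only-p with A v x in e
  ... | false = count-≤1 l (AllPairs.tail u) (λ w∈ → only-p (there w∈))
  ... | true with only-p (here refl) e
  ... | refl = s≤s (≤-reflexive (count-none l rest-false))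
    where
    rest-false : ∀ {w} → w ∈ l → A v w ≡ false
    rest-false {w} w∈ with A v w in e′
    ... | false = refl
    ... | true with only-p (there w∈) e′
    ... | refl = ⊥-elim (Unique[x∷xs]⇒x∉xs u w∈)

  count-≤2 : ∀ {p q} l → Unique l → (∀ {w} → w ∈ l → A v w ≡ true → w ≡ p ⊎ w ≡ q) →
             edge-count l ≤ 2
  count-≤2 []      _ _ = z≤n
  count-≤2 {p} {q} (x ∷ l) u only-pq with A v x in e
  ... | false = count-≤2 l (AllPairs.tail u) (λ w∈ → only-pq (there w∈))
  ... | true with only-pq (here refl) e
  ... | inj₁ refl = s≤s (count-≤1 l (AllPairs.tail u) only-q)
    where
    only-q : ∀ {w} → w ∈ l → A v w ≡ true → w ≡ q
    only-q w∈ e′ with only-pq (there w∈) e′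
    ... | inj₁ refl = ⊥-elim (Unique[x∷xs]⇒x∉xs u w∈)
    ... | inj₂ w≡q  = w≡q
  ... | inj₂ refl = s≤s (count-≤1 l (AllPairs.tail u) only-p)
    where
    only-p : ∀ {w} → w ∈ l → A v w ≡ true → w ≡ p
    only-p w∈ e′ with only-pq (there w∈) e′
    ... | inj₁ w≡p  = w≡p
    ... | inj₂ refl = ⊥-elim (Unique[x∷xs]⇒x∉xs u w∈)

  count-≥1 : ∀ {x} l → x ∈ l → A v x ≡ true → 1 ≤ edge-count l
  count-≥1 (y ∷ l) (here refl) e rewrite e = s≤s z≤n
  count-≥1 (y ∷ l) (there x∈) e = ≤-trans (count-≥1 l x∈ e) (m≤n+m _ _)

  count-≥2 : ∀ {x y} l → x ∈ l → y ∈ l → x ≢ y → A v x ≡ true → A v y ≡ true → 2 ≤ edge-count l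
  count-≥2 (z ∷ l) (here refl) (here refl) x≢y _  _  = ⊥-elim (x≢y refl)
  count-≥2 (z ∷ l) (here refl) (there y∈)  _   ex ey rewrite ex = s≤s (count-≥1 l y∈ ey)
  count-≥2 (z ∷ l) (there x∈)  (here refl) _   ex ey rewrite ey = s≤s (count-≥1 l x∈ ex)
  count-≥2 (z ∷ l) (there x∈)  (there y∈)  x≢y ex ey = ≤-trans (count-≥2 l x∈ y∈ x≢y ex ey) (m≤n+m _ _)

  degree-one-unique : degree A v ≡ 1 → ∀ {x y} → A v x ≡ true → A v y ≡ true → x ≡ y
  degree-one-unique deg {x} {y} ex ey with x ≟ y
  ... | yes x≡y = x≡y
  ... | no  x≢y with ≤-trans (count-≥2 (allFin m) (∈-allFin x) (∈-allFin y) x≢y ex ey) (≤-reflexive deg)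
  ... | s≤s ()

  some-neighbour : degree A v ≢ 0 → Σ (Fin m) λ w → A v w ≡ true
  some-neighbour deg≢0 with any? (λ w → A v w Bool.≟ true)
  ... | yes found = found
  ... | no  none  = ⊥-elim (deg≢0 (count-none (allFin m) (λ {w} _ → not-true w)))
    where
    not-true : ∀ w → A v w ≡ false
    not-true w with A v w in e
    ... | false = refl
    ... | true  = ⊥-elim (none (w , e))

  another-neighbour : ∀ {p} → A v p ≡ true → degree A v ≢ 1 →
                      Σ (Fin m) λ t → A v t ≡ true × t ≢ p
  another-neighbour {p} ep deg≢1 with any? (λ w → (A v w Bool.≟ true) ×-dec ¬? (w ≟ p))
  ... | yes found = found
  ... | no  none  = ⊥-elim (deg≢1 (≤-antisym (count-≤1 (allFin m) (allFin⁺ m) (λ _ → only-p _))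
                                              (count-≥1 (allFin m) (∈-allFin p) ep)))
    where
    only-p : ∀ w → A v w ≡ true → w ≡ p
    only-p w e with w ≟ p
    ... | yes w≡p = w≡p
    ... | no  w≢p = ⊥-elim (none (w , e , w≢p))

  third-neighbour : ∀ {p q} → A v p ≡ true → A v q ≡ true → p ≢ q → degree A v ≢ 2 →
                    Σ (Fin m) λ t → A v t ≡ true × t ≢ p × t ≢ q
  third-neighbour {p} {q} ep eq p≢q deg≢2
    with any? (λ w → (A v w Bool.≟ true) ×-dec (¬? (w ≟ p) ×-dec ¬? (w ≟ q)))
  ... | yes found = found
  ... | no  none  =
    ⊥-elim (deg≢2 (≤-antisym (count-≤2 (allFin m) (allFin⁺ m) (λ _ → only-pq _))
                             (count-≥2 (allFin m) (∈-allFin p) (∈-allFin q) p≢q ep eq)))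
    where
    only-pq : ∀ w → A v w ≡ true → w ≡ p ⊎ w ≡ q
    only-pq w e with w ≟ p | w ≟ q
    ... | yes w≡p | _       = inj₁ w≡p
    ... | no  _   | yes w≡q = inj₂ w≡q
    ... | no  w≢p | no  w≢q = ⊥-elim (none (w , e , w≢p , w≢q))

module PhyloTree (G : LabelledGraph) (ph : IsPhyloTree G) where

  V : Set
  V = Fin (n G)

  A : V → V → Bool
  A = adj G

  L : Label → V
  L = leaf G

  irrefl : ∀ a → A a a ≡ false
  irrefl = proj₁ (proj₁ ph)

  symm : ∀ a b → A a b ≡ A b a
  symm = proj₁ (proj₂ (proj₁ ph))

  connected : Connected A
  connected = proj₁ (proj₂ (proj₂ (proj₁ ph)))

  leaf-injective : ∀ x y → L x ≡ L y → x ≡ y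
  leaf-injective = proj₁ (proj₂ ph)

  leaf-degree : ∀ x → degree A (L x) ≡ 1
  leaf-degree = proj₁ (proj₂ (proj₂ ph))

  degree-one-leaf : ∀ v → degree A v ≡ 1 → Σ Label λ x → L x ≡ v
  degree-one-leaf = proj₁ (proj₂ (proj₂ (proj₂ ph)))

  no-degree-two : ∀ v → degree A v ≢ 2
  no-degree-two = proj₂ (proj₂ (proj₂ (proj₂ ph)))

  open Walks A public
  open Forest A irrefl symm (proj₂ (proj₂ (proj₂ (proj₁ ph)))) public

  Internal : V → Set
  Internal u = ∀ x → L x ≢ u

  internal-degree : ∀ {u} → Internal u → degree A u ≢ 1
  internal-degree u-int deg with degree-one-leaf _ deg
  ... | x , Lx≡u = u-int x Lx≡u

  leaf-neighbour : ∀ {x p w} → A p (L x) ≡ true → A (L x) w ≡ true → p ≡ w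
  leaf-neighbour {x} p~Lx Lx~w = Degree.degree-one-unique A (L x) (leaf-degree x) (adjacent-sym p~Lx) Lx~w

  attachment : ∀ x → Σ V λ w → A (L x) w ≡ true
  attachment x = Degree.some-neighbour A (L x) λ deg → one≢zero (trans (sym (leaf-degree x)) deg)
    where
    one≢zero : 1 ≢ 0
    one≢zero ()

  attach : Label → V
  attach x = proj₁ (attachment x)

  Toward : V → Label → V → Set
  Toward u z w = Σ (List V) λ xs → IsPath A u (L z) (u ∷ w ∷ xs)

  toward-unique : ∀ {u z w w′} → Toward u z w → Toward u z w′ → w ≡ w′
  toward-unique (_ , π) (_ , π′) with path-unique π π′
  ... | refl = refl

  toward-adjacent : ∀ {u z w} → Toward u z w → A u w ≡ true
  toward-adjacent (_ , w , _) = proj₁ (walk-uncons w)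

  toward-exists : ∀ {u z} → u ≢ L z → Σ V (Toward u z)
  toward-exists {u} {z} u≢Lz with connected u (L z)
  ... | _ , w , u-uniq with walk-first-edge w u≢Lz
  ... | y , rest , refl , _ , _ = y , rest , (w , u-uniq)

  adjacent-toward : ∀ {u z} → A u (L z) ≡ true → Toward u z (L z)
  adjacent-toward u~Lz =
    [] , step u~Lz here , unique-cons (λ { (here u≡Lz) → adjacent-distinct u~Lz u≡Lz }) (unique-cons (λ ()) [])

  distinguished : ∀ {u u′ z w w′} → Toward u z w → Toward u′ z w′ → w ≢ w′ → u ≢ u′
  distinguished tw tw′ w≢w′ refl = w≢w′ (toward-unique tw tw′)

  toward-leaf : ∀ {u z y} → Toward u z (L y) → y ≡ z
  toward-leaf {z = z} {y} (_ , w₀ , u-uniq) with walk-uncons w₀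
  ... | u~Ly , w with L y ≟ L z
  ... | yes same = leaf-injective _ _ same
  ... | no  diff with walk-first-edge w diff
  ... | c , _ , refl , Ly~c , _ =
    ⊥-elim (Unique[x∷xs]⇒x∉xs u-uniq (there (here (leaf-neighbour u~Ly Ly~c))))

  toward-back : ∀ {u w z v} → A u w ≡ true → Toward u z v → v ≢ w → Toward w z u
  toward-back {u} {w} u~w (xs , w₀ , u-uniq) v≢w with walk-uncons w₀
  ... | u~v , w₁ = _ ∷ xs , step (adjacent-sym u~w) w₀ , unique-cons w∉ u-uniq
    where
    w∉ : w ∉ u ∷ _ ∷ xs
    w∉ (here w≡u) = adjacent-distinct u~w (sym w≡u)
    w∉ (there w∈) = no-shortcut u~v u~w v≢w (w₁ , AllPairs.tail u-uniq)
                                (Unique[x∷xs]⇒x∉xs u-uniq) w∈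

  toward-next : ∀ {u z v} → Toward u z v → v ≢ L z → Σ V λ t → Toward v z t × t ≢ u
  toward-next (xs , w₀ , u-uniq) v≢Lz with walk-uncons w₀
  ... | _ , w with walk-first-edge w v≢Lz
  ... | t , rest , refl , _ , _ =
    t , (rest , w , AllPairs.tail u-uniq) , λ t≡u → Unique[x∷xs]⇒x∉xs u-uniq (there (here (sym t≡u)))

  -- Two different branches at u join into a leaf-to-leaf path through u.
  -- The two halves are disjoint: a common vertex c would give two paths
  -- from u to c with different first steps.
  through : ∀ {u a b v w} → Toward u a v → Toward u b w → v ≢ w →
            Σ (List V) λ xs → IsPath A (L a) (L b) xs × u ∈ xs
  through {u} {v = v} {w} (ps , wp , up) (rs , wr , ur) v≢w =
    reverse (u ∷ v ∷ ps) ++ w ∷ rs ,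
    (walk-++ {xs = reverse (u ∷ v ∷ ps)} (walk-reverse symm wp) wr ,
     ++⁺ {xs = reverse (u ∷ v ∷ ps)} (unique-reverse _ up) (AllPairs.tail ur) disjoint) ,
    ∈-++⁺ˡ (AnyProps.reverse⁺ {xs = u ∷ v ∷ ps} (here refl))
    where
    disjoint : Disjoint (reverse (u ∷ v ∷ ps)) (w ∷ rs)
    disjoint (c∈₁ , c∈₂) with AnyProps.reverse⁻ {xs = u ∷ v ∷ ps} c∈₁
    ... | here refl = Unique[x∷xs]⇒x∉xs ur c∈₂
    ... | there c∈ with walk-uncons wp | walk-uncons wr
    ... | u~v , w₁ | u~w , w₂
      with path-prefix (w₁ , AllPairs.tail up) c∈ | path-prefix (w₂ , AllPairs.tail ur) c∈₂
    ... | ys₁ , (wy₁ , uy₁) , ⊆₁ | ys₂ , (wy₂ , uy₂) , ⊆₂ with walk-from wy₁ | walk-from wy₂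
    ... | _ , refl | _ , refl
      with path-unique (step u~v wy₁ , unique-cons (λ u∈ → Unique[x∷xs]⇒x∉xs up (⊆₁ u∈)) uy₁)
                       (step u~w wy₂ , unique-cons (λ u∈ → Unique[x∷xs]⇒x∉xs ur (⊆₂ u∈)) uy₂)
    ... | refl = v≢w refl

  quartet-branches : ∀ {q u v₁ v₂ w₁ w₂} → DisplaysQ G q →
                     Toward u (a q) v₁ → Toward u (b q) v₂ → v₁ ≢ v₂ →
                     Toward u (c q) w₁ → Toward u (d q) w₂ → w₁ ≡ w₂
  quartet-branches {w₁ = w₁} {w₂} displayed ta tb va≢vb tc td with w₁ ≟ w₂
  ... | yes same = same
  ... | no  diff with through ta tb va≢vb | through tc td diff
  ... | xs , πab , u∈xs | ys , πcd , u∈ys = ⊥-elim (displayed xs ys πab πcd _ u∈xs u∈ys)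

  -- Every neighbour w of u lies on the branch of u towards some leaf: walk
  -- from u through w, never turning back, until a leaf is reached.  A
  -- non-leaf has a further neighbour, which is new since G has no cycle; the
  -- walk has no repeated vertex, so it stops after at most n G steps.
  toward-some-leaf : ∀ {u w} → A u w ≡ true → Σ Label λ x → Toward u x w
  toward-some-leaf {u} {w} u~w =
    extend (n G) {pre = []} (adjacent-sym u~w) here
      (unique-cons (λ { (here w≡u) → adjacent-distinct u~w (sym w≡u) }) (unique-cons (λ ()) []))
      refl (m<n+m (n G) (s≤s z≤n))
    where
    -- y is the tip, y ∷ y′ ∷ rest the path back to u, which ends in w, u.
    extend : (fuel : ℕ) → ∀ {y y′ rest pre} → A y y′ ≡ true → Walk A y′ u (y′ ∷ rest) →
             Unique (y ∷ y′ ∷ rest) → y ∷ y′ ∷ rest ≡ pre ++ w ∷ u ∷ [] →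
             n G < length (y ∷ y′ ∷ rest) + fuel → Σ Label λ x → Toward u x w
    extend zero {y} {y′} {rest} _ _ uniq _ bound =
      ⊥-elim (<⇒≱ (subst (n G <_) (+-identityʳ _) bound) (unique-length (y ∷ y′ ∷ rest) uniq))
    extend (suc fuel) {y} {y′} {rest} {pre} y~y′ back uniq ends bound
      with degree A y ℕ.≟ 1
    ... | yes deg with degree-one-leaf y deg
    ...   | x , refl = x , reverse pre , subst (IsPath A u (L x)) to-u∷w
                         (walk-reverse symm (step y~y′ back) , unique-reverse _ uniq)
      where
      to-u∷w : reverse (L x ∷ y′ ∷ rest) ≡ u ∷ w ∷ reverse pre
      to-u∷w = trans (cong reverse ends) (reverse-++ pre (w ∷ u ∷ []))
    extend (suc fuel) {y} {y′} {rest} {pre} y~y′ back uniq ends bound | no deg≢1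
      with Degree.another-neighbour A y y~y′ deg≢1
    ... | t , y~t , t≢y′ =
      extend fuel {pre = t ∷ pre} (adjacent-sym y~t) (step y~y′ back) (unique-cons t∉ uniq) (cong (t ∷_) ends)
             (subst (n G <_) (+-suc _ fuel) bound)
      where
      t∉ : t ∉ y ∷ y′ ∷ rest
      t∉ (here t≡y) = adjacent-distinct y~t (sym t≡y)
      t∉ (there t∈) = no-shortcut y~y′ y~t (λ y′≡t → t≢y′ (sym y′≡t))
                        (back , AllPairs.tail uniq) (Unique[x∷xs]⇒x∉xs uniq) t∈

  third-label : (x y : Label) → Σ Label λ z → z ≢ x × z ≢ y
  third-label zero          zero          = l2 , (λ ()) , (λ ())
  third-label zero          (suc zero)    = l3 , (λ ()) , (λ ())
  third-label zero          (suc (suc _)) = l2 , (λ ()) , (λ ())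
  third-label (suc zero)    zero          = l3 , (λ ()) , (λ ())
  third-label (suc zero)    (suc _)       = l1 , (λ ()) , (λ ())
  third-label (suc (suc _)) zero          = l2 , (λ ()) , (λ ())
  third-label (suc (suc _)) (suc _)       = l1 , (λ ()) , (λ ())

  -- The attachment vertex of a leaf is internal (there are at least three leaves).
  attach-internal : ∀ x → Internal (attach x)
  attach-internal x y Ly≡attach with third-label x y
  ... | z , z≢x , z≢y with toward-exists {L x} {z} (λ e → z≢x (sym (leaf-injective _ _ e)))
  ... | w , tw with leaf-neighbour (adjacent-sym (proj₂ (attachment x))) (toward-adjacent tw)
  ... | refl = z≢y (sym (toward-leaf (subst (Toward (L x) z) (sym Ly≡attach) tw)))

  toward-previous : ∀ {u v z w w′} → A u v ≡ true → Toward u z w → w ≢ v → Toward v z w′ → w′ ≡ u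
  toward-previous u~v tw w≢v tw′ = toward-unique tw′ (toward-back u~v tw w≢v)

  away-from-previous : ∀ {u v z w} → Internal v → Toward u z v → Toward v z w → w ≢ u
  away-from-previous {z = z} v-int tv tw with toward-next tv (λ v≡Lz → v-int z (sym v≡Lz))
  ... | t , to-t , t≢u rewrite toward-unique tw to-t = t≢u

  module Centre (u : V) (u-internal : Internal u) where

    branch : Label → V
    branch z = proj₁ (toward-exists λ u≡Lz → u-internal z (sym u≡Lz))

    branch-toward : ∀ z → Toward u z (branch z)
    branch-toward z = proj₂ (toward-exists λ u≡Lz → u-internal z (sym u≡Lz))

    branch-adjacent : ∀ z → A u (branch z) ≡ true
    branch-adjacent z = toward-adjacent (branch-toward z)

    branch-leaf : ∀ {y z} → branch z ≡ L y → y ≡ z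
    branch-leaf {z = z} e = toward-leaf (subst (Toward u z) e (branch-toward z))

    hangs : ∀ {z} → branch z ≡ L z → A u (L z) ≡ true
    hangs {z} e = subst (λ t → A u t ≡ true) e (branch-adjacent z)

    neighbour-branch : ∀ {t} → A u t ≡ true → Σ Label λ y → branch y ≡ t
    neighbour-branch u~t with toward-some-leaf u~t
    ... | y , ty = y , toward-unique (branch-toward y) ty

    shared-branch-internal : ∀ {y z} → y ≢ z → branch y ≡ branch z → Internal (branch z)
    shared-branch-internal {y} {z} y≢z same x Lx≡b =
      y≢z (trans (sym (branch-leaf (trans same (sym Lx≡b)))) (branch-leaf (sym Lx≡b)))

    not-two-branches : ∀ P Q → (∀ z → branch z ≡ P ⊎ branch z ≡ Q) → ⊥
    not-two-branches P Q two
      with Degree.another-neighbour A u (branch-adjacent l1) (internal-degree u-internal)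
    ... | t₁ , u~t₁ , t₁≢b
      with Degree.third-neighbour A u (branch-adjacent l1) u~t₁ (λ e → t₁≢b (sym e)) (no-degree-two u)
    ... | t₂ , u~t₂ , t₂≢b , t₂≢t₁ =
      three-in-two (λ e → t₁≢b (sym e)) (λ e → t₂≢b (sym e)) (λ e → t₂≢t₁ (sym e))
                   (two l1) (neighbour-in u~t₁) (neighbour-in u~t₂)
      where
      neighbour-in : ∀ {t} → A u t ≡ true → t ≡ P ⊎ t ≡ Q
      neighbour-in u~t with neighbour-branch u~t
      ... | y , refl = two y
      three-in-two : ∀ {a b c : V} → a ≢ b → a ≢ c → b ≢ c →
                     a ≡ P ⊎ a ≡ Q → b ≡ P ⊎ b ≡ Q → c ≡ P ⊎ c ≡ Q → ⊥
      three-in-two a≢b _ _ (inj₁ refl) (inj₁ refl) _ = a≢b refl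
      three-in-two a≢b _ _ (inj₂ refl) (inj₂ refl) _ = a≢b refl
      three-in-two _ a≢c _ (inj₁ refl) _ (inj₁ refl) = a≢c refl
      three-in-two _ a≢c _ (inj₂ refl) _ (inj₂ refl) = a≢c refl
      three-in-two _ _ b≢c _ (inj₁ refl) (inj₁ refl) = b≢c refl
      three-in-two _ _ b≢c _ (inj₂ refl) (inj₂ refl) = b≢c refl

    -- Otherwise its branch vertex s is internal and has two neighbours besides
    -- u; each starts a branch towards some leaf, which can only be z, since
    -- every other label is reached from s through u.
    pendant : ∀ z → (∀ y → y ≢ z → branch y ≢ branch z) → branch z ≡ L z
    pendant z separated with branch z ≟ L z
    ... | yes is-leaf = is-leaf
    ... | no  s≢Lz    = ⊥-elim two-branches-to-z
      where
      s~u : A (branch z) u ≡ true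
      s~u = adjacent-sym (branch-adjacent z)

      s-internal : Internal (branch z)
      s-internal x Lx≡s with branch-leaf (sym Lx≡s)
      ... | refl = s≢Lz (sym Lx≡s)

      only-z : ∀ {t y} → t ≢ u → Toward (branch z) y t → y ≡ z
      only-z {y = y} t≢u ty with y ≟ z
      ... | yes y≡z = y≡z
      ... | no  y≢z = ⊥-elim (t≢u (toward-previous (branch-adjacent z) (branch-toward y)
                                                    (separated y y≢z) ty))

      two-branches-to-z : ⊥
      two-branches-to-z
        with Degree.another-neighbour A (branch z) s~u (internal-degree s-internal)
      ... | t₁ , s~t₁ , t₁≢u
        with Degree.third-neighbour A (branch z) s~u s~t₁ (λ e → t₁≢u (sym e)) (no-degree-two _)
      ... | t₂ , s~t₂ , t₂≢u , t₂≢t₁ with toward-some-leaf s~t₁ | toward-some-leaf s~t₂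
      ... | y₁ , ty₁ | y₂ , ty₂ with only-z t₁≢u ty₁ | only-z t₂≢u ty₂
      ... | refl | refl = t₂≢t₁ (toward-unique ty₂ ty₁)

    peel : ∀ {P x r} → branch x ≢ P →
           (∀ z → branch z ≡ P ⊎ z ≡ x ⊎ branch z ≡ branch r) →
           branch x ≡ L x × branch x ≢ branch r
    peel {P} {x} {r} x↛P classify = pendant x separated , x≢r
      where
      x≢r : branch x ≢ branch r
      x≢r same = not-two-branches P (branch r) two
        where
        two : ∀ z → branch z ≡ P ⊎ branch z ≡ branch r
        two z with classify z
        ... | inj₁ z→P         = inj₁ z→P
        ... | inj₂ (inj₁ refl) = inj₂ same
        ... | inj₂ (inj₂ z→r)  = inj₂ z→r

      separated : ∀ y → y ≢ x → branch y ≢ branch x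
      separated y y≢x with classify y
      ... | inj₁ y→P         = λ e → x↛P (trans (sym e) y→P)
      ... | inj₂ (inj₁ y≡x)  = ⊥-elim (y≢x y≡x)
      ... | inj₂ (inj₂ y→r)  = λ e → x≢r (trans (sym e) y→r)

    cherry : ∀ {P x y} → branch x ≢ P → branch y ≢ P →
             (∀ z → branch z ≡ P ⊎ z ≡ x ⊎ z ≡ y) → branch x ≡ L x × branch y ≡ L y
    cherry {P} {x} {y} x↛P y↛P classify =
      proj₁ (peel x↛P (λ z → Sum.map₂ (Sum.map₂ (λ { refl → refl })) (classify z))) ,
      proj₁ (peel y↛P (λ z → Sum.map₂ swap-xy (classify z)))
      where
      swap-xy : ∀ {z} → z ≡ x ⊎ z ≡ y → z ≡ y ⊎ branch z ≡ branch x
      swap-xy (inj₁ refl) = inj₂ refl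
      swap-xy (inj₂ z≡y)  = inj₁ z≡y

  module Consecutive {u} (u-internal : Internal u) (r : Label)
                     (v-internal : Internal (Centre.branch u u-internal r)) where
    private
      module U = Centre u u-internal
      module W = Centre (U.branch r) v-internal

    behind : ∀ z → U.branch z ≢ U.branch r → W.branch z ≡ u
    behind z z↛v = toward-previous (U.branch-adjacent r) (U.branch-toward z) z↛v (W.branch-toward z)

    ahead : ∀ z → U.branch z ≡ U.branch r → W.branch z ≢ u
    ahead z z→v = away-from-previous v-internal (subst (Toward u z) z→v (U.branch-toward z))
                                     (W.branch-toward z)

neighbours : (H : LabelledGraph) → Fin (n H) → List (Fin (n H))
neighbours H i = filter (λ j → adj H i j Bool.≟ true) (allFin (n H))

module Recognition (G H : LabelledGraph) (G-connected : Connected (adj G))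
  (σ : Fin (n H) → Fin (n G))
  (σ-injective : ∀ i j → σ i ≡ σ j → i ≡ j)
  (σ-edges : ∀ i → All (λ j → adj G (σ i) (σ j) ≡ true) (neighbours H i))
  (σ-closed : ∀ i {w} → adj G (σ i) w ≡ true → Any (λ j → σ j ≡ w) (neighbours H i))
  (σ-leaves : ∀ x → σ (leaf H x) ≡ leaf G x) where

  -- σ is onto: follow a walk from the leaf 1, which is in the image.
  onto : ∀ v → Σ (Fin (n H)) λ i → σ i ≡ v
  onto v = along (proj₁ (proj₂ (G-connected (leaf G l1) v))) (leaf H l1 , σ-leaves l1)
    where
    along : ∀ {a b xs} → Walk (adj G) a b xs → Σ _ (λ i → σ i ≡ a) → Σ _ (λ i → σ i ≡ b)
    along here       reached    = reached
    along (step e w) (i , refl) = along w (satisfied (σ-closed i e))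

  -- σ preserves adjacency, and reflects it by closedness and injectivity.
  σ-adjacency : ∀ i j → adj G (σ i) (σ j) ≡ adj H i j
  σ-adjacency i j with adj H i j in e
  ... | true  = All.lookup (σ-edges i) (∈-filter⁺ (λ j → adj H i j Bool.≟ true) (∈-allFin j) e)
  ... | false with adj G (σ i) (σ j) in e′
  ...   | false = refl
  ...   | true with find (σ-closed i e′)
  ...     | k , k∈ , σk≡σj with σ-injective k j σk≡σj
  ...       | refl with trans (sym e) (proj₂ (∈-filter⁻ (λ j → adj H i j Bool.≟ true) {xs = allFin (n H)} k∈))
  ...         | ()

  τ : Fin (n G) → Fin (n H)
  τ v = proj₁ (onto v)

  στ : ∀ v → σ (τ v) ≡ v
  στ v = proj₂ (onto v)

  iso : Iso G H
  iso = record
    { to        = τ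
    ; from      = σ
    ; from-to   = στ
    ; to-from   = λ i → σ-injective _ _ (στ (σ i))
    ; adj-pres  = λ u v → trans (sym (σ-adjacency (τ u) (τ v))) (cong₂ (adj G) (στ u) (στ v))
    ; leaf-pres = λ x → σ-injective _ _ (trans (στ (leaf G x)) (sym (σ-leaves x)))
    }

glue-injective : ∀ {a b} {B : Set} (f : Fin a → B) (g : Fin b → B) →
                 (∀ i j → f i ≡ f j → i ≡ j) → (∀ i j → g i ≡ g j → i ≡ j) → (∀ i j → f i ≢ g j) →
                 ∀ s t → [ f , g ]′ (splitAt a s) ≡ [ f , g ]′ (splitAt a t) → s ≡ t
glue-injective {a} {b} f g f-inj g-inj apart s t same = begin
    s                          ≡⟨ join-splitAt a b s ⟨
    join a b (splitAt a s)     ≡⟨ cong (join a b) (sum-injective (splitAt a s) (splitAt a t) same) ⟩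
    join a b (splitAt a t)     ≡⟨ join-splitAt a b t ⟩
    t                          ∎
  where
  open ≡-Reasoning
  sum-injective : ∀ x y → [ f , g ]′ x ≡ [ f , g ]′ y → x ≡ y
  sum-injective (inj₁ i) (inj₁ j) e = cong inj₁ (f-inj i j e)
  sum-injective (inj₁ i) (inj₂ j) e = ⊥-elim (apart i j e)
  sum-injective (inj₂ i) (inj₁ j) e = ⊥-elim (apart j i (sym e))
  sum-injective (inj₂ i) (inj₂ j) e = cong inj₂ (g-inj i j e)

pattern ℓ₁ = zero
pattern ℓ₂ = suc zero
pattern ℓ₃ = suc (suc zero)
pattern ℓ₄ = suc (suc (suc zero))
pattern ℓ₅ = suc (suc (suc (suc zero)))
pattern ℓ₆ = suc (suc (suc (suc (suc zero))))

pattern s₁ = suc ℓ₆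
pattern s₂ = suc s₁
pattern s₃ = suc s₂
pattern s₄ = suc s₃

q₁ q₂ q₃ q₄ : Quartet
q₁ = (l1 , l2) ∣q (l3 , l5)
q₂ = (l1 , l3) ∣q (l4 , l6)
q₃ = (l1 , l2) ∣q (l5 , l6)
q₄ = (l2 , l4) ∣q (l5 , l6)

-- Starting at the
-- attachment vertex v₁ of leaf 1 we walk along the spine v₁ v₂ v₃ v₄.  At each
-- spine vertex the quartets show that all labels ahead except one share a
-- branch; 'peel' then shows that this one label is a leaf hanging there, and
-- the shared branch leads to the next spine vertex.
module Reconstruction (G : LabelledGraph) (ph : IsPhyloTree G)
  (d₁ : DisplaysQ G q₁) (d₂ : DisplaysQ G q₂) (d₃ : DisplaysQ G q₃) (d₄ : DisplaysQ G q₄) where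

  open PhyloTree G ph

  v₁ : V
  v₁ = attach ℓ₁

  i₁ : Internal v₁
  i₁ = attach-internal ℓ₁

  module C₁ = Centre v₁ i₁
  β₁ : Label → V
  β₁ = C₁.branch

  β₁-1 : β₁ ℓ₁ ≡ L ℓ₁
  β₁-1 = toward-unique (C₁.branch-toward ℓ₁) (adjacent-toward (adjacent-sym (proj₂ (attachment ℓ₁))))

  β₁-not-1 : ∀ z → z ≢ ℓ₁ → β₁ z ≢ L ℓ₁
  β₁-not-1 z z≢1 e = z≢1 (sym (C₁.branch-leaf e))

  β₁1≢β₁2 : β₁ ℓ₁ ≢ β₁ ℓ₂
  β₁1≢β₁2 e = β₁-not-1 ℓ₂ (λ ()) (trans (sym e) β₁-1)

  β₁1≢β₁3 : β₁ ℓ₁ ≢ β₁ ℓ₃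
  β₁1≢β₁3 e = β₁-not-1 ℓ₃ (λ ()) (trans (sym e) β₁-1)

  β₁3≡β₁5 : β₁ ℓ₃ ≡ β₁ ℓ₅
  β₁3≡β₁5 = quartet-branches {q = q₁} d₁ (C₁.branch-toward ℓ₁) (C₁.branch-toward ℓ₂) β₁1≢β₁2
                             (C₁.branch-toward ℓ₃) (C₁.branch-toward ℓ₅)

  β₁4≡β₁6 : β₁ ℓ₄ ≡ β₁ ℓ₆
  β₁4≡β₁6 = quartet-branches {q = q₂} d₂ (C₁.branch-toward ℓ₁) (C₁.branch-toward ℓ₃) β₁1≢β₁3
                             (C₁.branch-toward ℓ₄) (C₁.branch-toward ℓ₆)

  β₁5≡β₁6 : β₁ ℓ₅ ≡ β₁ ℓ₆
  β₁5≡β₁6 = quartet-branches {q = q₃} d₃ (C₁.branch-toward ℓ₁) (C₁.branch-toward ℓ₂) β₁1≢β₁2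
                             (C₁.branch-toward ℓ₅) (C₁.branch-toward ℓ₆)

  β₁5≡β₁3 : β₁ ℓ₅ ≡ β₁ ℓ₃
  β₁5≡β₁3 = sym β₁3≡β₁5

  β₁6≡β₁3 : β₁ ℓ₆ ≡ β₁ ℓ₃
  β₁6≡β₁3 = trans (sym β₁5≡β₁6) β₁5≡β₁3

  β₁4≡β₁3 : β₁ ℓ₄ ≡ β₁ ℓ₃
  β₁4≡β₁3 = trans β₁4≡β₁6 β₁6≡β₁3

  classify₁ : ∀ z → β₁ z ≡ L ℓ₁ ⊎ z ≡ ℓ₂ ⊎ β₁ z ≡ β₁ ℓ₃
  classify₁ ℓ₁ = inj₁ β₁-1
  classify₁ ℓ₂ = inj₂ (inj₁ refl)
  classify₁ ℓ₃ = inj₂ (inj₂ refl)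
  classify₁ ℓ₄ = inj₂ (inj₂ β₁4≡β₁3)
  classify₁ ℓ₅ = inj₂ (inj₂ β₁5≡β₁3)
  classify₁ ℓ₆ = inj₂ (inj₂ β₁6≡β₁3)

  peel₁ : β₁ ℓ₂ ≡ L ℓ₂ × β₁ ℓ₂ ≢ β₁ ℓ₃
  peel₁ = C₁.peel (β₁-not-1 ℓ₂ (λ ())) classify₁

  v₂ : V
  v₂ = β₁ ℓ₃

  i₂ : Internal v₂
  i₂ = C₁.shared-branch-internal {ℓ₄} (λ ()) β₁4≡β₁3

  module C₂ = Centre v₂ i₂
  module S₁₂ = Consecutive i₁ ℓ₃ i₂
  β₂ : Label → V
  β₂ = C₂.branch

  β₂-1 : β₂ ℓ₁ ≡ v₁
  β₂-1 = S₁₂.behind ℓ₁ (λ e → i₂ ℓ₁ (trans (sym β₁-1) e))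

  β₂-2 : β₂ ℓ₂ ≡ v₁
  β₂-2 = S₁₂.behind ℓ₂ (proj₂ peel₁)

  β₂3≢v₁ : β₂ ℓ₃ ≢ v₁
  β₂3≢v₁ = S₁₂.ahead ℓ₃ refl

  β₂4≢v₁ : β₂ ℓ₄ ≢ v₁
  β₂4≢v₁ = S₁₂.ahead ℓ₄ β₁4≡β₁3

  β₂4≡β₂6 : β₂ ℓ₄ ≡ β₂ ℓ₆
  β₂4≡β₂6 = quartet-branches {q = q₂} d₂ (C₂.branch-toward ℓ₁) (C₂.branch-toward ℓ₃)
                             (λ e → β₂3≢v₁ (trans (sym e) β₂-1))
                             (C₂.branch-toward ℓ₄) (C₂.branch-toward ℓ₆)

  β₂5≡β₂6 : β₂ ℓ₅ ≡ β₂ ℓ₆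
  β₂5≡β₂6 = quartet-branches {q = q₄} d₄ (C₂.branch-toward ℓ₂) (C₂.branch-toward ℓ₄)
                             (λ e → β₂4≢v₁ (trans (sym e) β₂-2))
                             (C₂.branch-toward ℓ₅) (C₂.branch-toward ℓ₆)

  β₂5≡β₂4 : β₂ ℓ₅ ≡ β₂ ℓ₄
  β₂5≡β₂4 = trans β₂5≡β₂6 (sym β₂4≡β₂6)

  classify₂ : ∀ z → β₂ z ≡ v₁ ⊎ z ≡ ℓ₃ ⊎ β₂ z ≡ β₂ ℓ₄
  classify₂ ℓ₁ = inj₁ β₂-1
  classify₂ ℓ₂ = inj₁ β₂-2
  classify₂ ℓ₃ = inj₂ (inj₁ refl)
  classify₂ ℓ₄ = inj₂ (inj₂ refl)
  classify₂ ℓ₅ = inj₂ (inj₂ β₂5≡β₂4)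
  classify₂ ℓ₆ = inj₂ (inj₂ (sym β₂4≡β₂6))

  peel₂ : β₂ ℓ₃ ≡ L ℓ₃ × β₂ ℓ₃ ≢ β₂ ℓ₄
  peel₂ = C₂.peel β₂3≢v₁ classify₂

  v₃ : V
  v₃ = β₂ ℓ₄

  i₃ : Internal v₃
  i₃ = C₂.shared-branch-internal {ℓ₅} (λ ()) β₂5≡β₂4

  module C₃ = Centre v₃ i₃
  module S₂₃ = Consecutive i₂ ℓ₄ i₃
  β₃ : Label → V
  β₃ = C₃.branch

  β₃-behind : ∀ z → β₂ z ≡ v₁ → β₃ z ≡ v₂
  β₃-behind z z→v₁ = S₂₃.behind z (λ e → β₂4≢v₁ (trans (sym e) z→v₁))

  β₃-3 : β₃ ℓ₃ ≡ v₂
  β₃-3 = S₂₃.behind ℓ₃ (proj₂ peel₂)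

  β₃4≢v₂ : β₃ ℓ₄ ≢ v₂
  β₃4≢v₂ = S₂₃.ahead ℓ₄ refl

  β₃5≡β₃6 : β₃ ℓ₅ ≡ β₃ ℓ₆
  β₃5≡β₃6 = quartet-branches {q = q₄} d₄ (C₃.branch-toward ℓ₂) (C₃.branch-toward ℓ₄)
                             (λ e → β₃4≢v₂ (trans (sym e) (β₃-behind ℓ₂ β₂-2)))
                             (C₃.branch-toward ℓ₅) (C₃.branch-toward ℓ₆)

  classify₃ : ∀ z → β₃ z ≡ v₂ ⊎ z ≡ ℓ₄ ⊎ β₃ z ≡ β₃ ℓ₅
  classify₃ ℓ₁ = inj₁ (β₃-behind ℓ₁ β₂-1)
  classify₃ ℓ₂ = inj₁ (β₃-behind ℓ₂ β₂-2)
  classify₃ ℓ₃ = inj₁ β₃-3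
  classify₃ ℓ₄ = inj₂ (inj₁ refl)
  classify₃ ℓ₅ = inj₂ (inj₂ refl)
  classify₃ ℓ₆ = inj₂ (inj₂ (sym β₃5≡β₃6))

  peel₃ : β₃ ℓ₄ ≡ L ℓ₄ × β₃ ℓ₄ ≢ β₃ ℓ₅
  peel₃ = C₃.peel β₃4≢v₂ classify₃

  v₄ : V
  v₄ = β₃ ℓ₅

  i₄ : Internal v₄
  i₄ = C₃.shared-branch-internal {ℓ₆} (λ ()) (sym β₃5≡β₃6)

  module C₄ = Centre v₄ i₄
  module S₃₄ = Consecutive i₃ ℓ₅ i₄
  β₄ : Label → V
  β₄ = C₄.branch

  β₄-behind : ∀ z → β₃ z ≡ v₂ → β₄ z ≡ v₃
  β₄-behind z z→v₂ = S₃₄.behind z (λ e → S₂₃.ahead ℓ₅ β₂5≡β₂4 (trans (sym e) z→v₂))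

  β₄-4 : β₄ ℓ₄ ≡ v₃
  β₄-4 = S₃₄.behind ℓ₄ (proj₂ peel₃)

  β₄5≢v₃ : β₄ ℓ₅ ≢ v₃
  β₄5≢v₃ = S₃₄.ahead ℓ₅ refl

  β₄6≢v₃ : β₄ ℓ₆ ≢ v₃
  β₄6≢v₃ = S₃₄.ahead ℓ₆ (sym β₃5≡β₃6)

  classify₄ : ∀ z → β₄ z ≡ v₃ ⊎ z ≡ ℓ₅ ⊎ z ≡ ℓ₆
  classify₄ ℓ₁ = inj₁ (β₄-behind ℓ₁ (β₃-behind ℓ₁ β₂-1))
  classify₄ ℓ₂ = inj₁ (β₄-behind ℓ₂ (β₃-behind ℓ₂ β₂-2))
  classify₄ ℓ₃ = inj₁ (β₄-behind ℓ₃ β₃-3)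
  classify₄ ℓ₄ = inj₁ β₄-4
  classify₄ ℓ₅ = inj₂ (inj₁ refl)
  classify₄ ℓ₆ = inj₂ (inj₂ refl)

  peel₄ : β₄ ℓ₅ ≡ L ℓ₅ × β₄ ℓ₆ ≡ L ℓ₆
  peel₄ = C₄.cherry β₄5≢v₃ β₄6≢v₃ classify₄

  spine : Fin 4 → V
  spine zero                   = v₁
  spine (suc zero)             = v₂
  spine (suc (suc zero))       = v₃
  spine (suc (suc (suc zero))) = v₄

  σ : Fin 10 → V
  σ i = [ L , spine ]′ (splitAt 6 i)

  v₁~L₁ : A v₁ (L ℓ₁) ≡ true
  v₁~L₁ = C₁.hangs β₁-1
  v₁~L₂ : A v₁ (L ℓ₂) ≡ true
  v₁~L₂ = C₁.hangs (proj₁ peel₁)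
  v₂~L₃ : A v₂ (L ℓ₃) ≡ true
  v₂~L₃ = C₂.hangs (proj₁ peel₂)
  v₃~L₄ : A v₃ (L ℓ₄) ≡ true
  v₃~L₄ = C₃.hangs (proj₁ peel₃)
  v₄~L₅ : A v₄ (L ℓ₅) ≡ true
  v₄~L₅ = C₄.hangs (proj₁ peel₄)
  v₄~L₆ : A v₄ (L ℓ₆) ≡ true
  v₄~L₆ = C₄.hangs (proj₂ peel₄)
  v₁~v₂ : A v₁ v₂ ≡ true
  v₁~v₂ = C₁.branch-adjacent ℓ₃
  v₂~v₃ : A v₂ v₃ ≡ true
  v₂~v₃ = C₂.branch-adjacent ℓ₄
  v₃~v₄ : A v₃ v₄ ≡ true
  v₃~v₄ = C₃.branch-adjacent ℓ₅

  σ-edges : ∀ i → All (λ j → A (σ i) (σ j) ≡ true) (neighbours T6 i)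
  σ-edges ℓ₁ = adjacent-sym v₁~L₁ ∷ []
  σ-edges ℓ₂ = adjacent-sym v₁~L₂ ∷ []
  σ-edges ℓ₃ = adjacent-sym v₂~L₃ ∷ []
  σ-edges ℓ₄ = adjacent-sym v₃~L₄ ∷ []
  σ-edges ℓ₅ = adjacent-sym v₄~L₅ ∷ []
  σ-edges ℓ₆ = adjacent-sym v₄~L₆ ∷ []
  σ-edges s₁ = v₁~L₁ ∷ v₁~L₂ ∷ v₁~v₂ ∷ []
  σ-edges s₂ = v₂~L₃ ∷ adjacent-sym v₁~v₂ ∷ v₂~v₃ ∷ []
  σ-edges s₃ = v₃~L₄ ∷ adjacent-sym v₂~v₃ ∷ v₃~v₄ ∷ []
  σ-edges s₄ = v₄~L₅ ∷ v₄~L₆ ∷ adjacent-sym v₃~v₄ ∷ []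

  -- At a spine vertex every neighbour is a branch vertex, so it suffices to
  -- locate the branch of each label among the images of the T6-neighbours.
  closed-at : ∀ {u} (u-int : Internal u) {l : List (Fin 10)} →
              (∀ y → Any (λ j → σ j ≡ Centre.branch u u-int y) l) →
              ∀ {w} → A u w ≡ true → Any (λ j → σ j ≡ w) l
  closed-at u-int located u~w with Centre.neighbour-branch _ u-int u~w
  ... | y , refl = located y

  σ-closed : ∀ i {w} → A (σ i) w ≡ true → Any (λ j → σ j ≡ w) (neighbours T6 i)
  σ-closed ℓ₁ e = here (leaf-neighbour v₁~L₁ e)
  σ-closed ℓ₂ e = here (leaf-neighbour v₁~L₂ e)
  σ-closed ℓ₃ e = here (leaf-neighbour v₂~L₃ e)
  σ-closed ℓ₄ e = here (leaf-neighbour v₃~L₄ e)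
  σ-closed ℓ₅ e = here (leaf-neighbour v₄~L₅ e)
  σ-closed ℓ₆ e = here (leaf-neighbour v₄~L₆ e)
  σ-closed s₁ = closed-at i₁ λ z → located (classify₁ z)
    where
    located : ∀ {z} → β₁ z ≡ L ℓ₁ ⊎ z ≡ ℓ₂ ⊎ β₁ z ≡ v₂ → Any (λ j → σ j ≡ β₁ z) (neighbours T6 s₁)
    located (inj₁ z→L₁)        = here (sym z→L₁)
    located (inj₂ (inj₁ refl)) = there (here (sym (proj₁ peel₁)))
    located (inj₂ (inj₂ z→v₂)) = there (there (here (sym z→v₂)))
  σ-closed s₂ = closed-at i₂ λ z → located (classify₂ z)
    where
    located : ∀ {z} → β₂ z ≡ v₁ ⊎ z ≡ ℓ₃ ⊎ β₂ z ≡ v₃ → Any (λ j → σ j ≡ β₂ z) (neighbours T6 s₂)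
    located (inj₁ z→v₁)        = there (here (sym z→v₁))
    located (inj₂ (inj₁ refl)) = here (sym (proj₁ peel₂))
    located (inj₂ (inj₂ z→v₃)) = there (there (here (sym z→v₃)))
  σ-closed s₃ = closed-at i₃ λ z → located (classify₃ z)
    where
    located : ∀ {z} → β₃ z ≡ v₂ ⊎ z ≡ ℓ₄ ⊎ β₃ z ≡ v₄ → Any (λ j → σ j ≡ β₃ z) (neighbours T6 s₃)
    located (inj₁ z→v₂)        = there (here (sym z→v₂))
    located (inj₂ (inj₁ refl)) = here (sym (proj₁ peel₃))
    located (inj₂ (inj₂ z→v₄)) = there (there (here (sym z→v₄)))
  σ-closed s₄ = closed-at i₄ λ z → located (classify₄ z)
    where
    located : ∀ {z} → β₄ z ≡ v₃ ⊎ z ≡ ℓ₅ ⊎ z ≡ ℓ₆ → Any (λ j → σ j ≡ β₄ z) (neighbours T6 s₄)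
    located (inj₁ z→v₃)        = there (there (here (sym z→v₃)))
    located (inj₂ (inj₁ refl)) = here (sym (proj₁ peel₄))
    located (inj₂ (inj₂ refl)) = there (here (sym (proj₂ peel₄)))

  -- The spine vertices are distinct: consecutive ones are adjacent, the
  -- others are told apart by their branches towards leaf 1 or leaf 3.
  v₁≢v₂ : v₁ ≢ v₂
  v₁≢v₂ = adjacent-distinct v₁~v₂
  v₂≢v₃ : v₂ ≢ v₃
  v₂≢v₃ = adjacent-distinct v₂~v₃
  v₃≢v₄ : v₃ ≢ v₄
  v₃≢v₄ = adjacent-distinct v₃~v₄

  β₃-1 : β₃ ℓ₁ ≡ v₂
  β₃-1 = β₃-behind ℓ₁ β₂-1

  β₄-1 : β₄ ℓ₁ ≡ v₃
  β₄-1 = β₄-behind ℓ₁ β₃-1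

  v₁≢v₃ : v₁ ≢ v₃
  v₁≢v₃ = distinguished (C₁.branch-toward ℓ₁) (C₃.branch-toward ℓ₁)
                        (λ e → i₂ ℓ₁ (trans (sym β₁-1) (trans e β₃-1)))
  v₁≢v₄ : v₁ ≢ v₄
  v₁≢v₄ = distinguished (C₁.branch-toward ℓ₁) (C₄.branch-toward ℓ₁)
                        (λ e → i₃ ℓ₁ (trans (sym β₁-1) (trans e β₄-1)))
  v₂≢v₄ : v₂ ≢ v₄
  v₂≢v₄ = distinguished (C₂.branch-toward ℓ₃) (C₄.branch-toward ℓ₃)
                        (λ e → i₃ ℓ₃ (trans (sym (proj₁ peel₂)) (trans e (β₄-behind ℓ₃ β₃-3))))

  spine-injective : ∀ i j → spine i ≡ spine j → i ≡ j
  spine-injective zero zero _ = refl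
  spine-injective zero (suc zero) e = ⊥-elim (v₁≢v₂ e)
  spine-injective zero (suc (suc zero)) e = ⊥-elim (v₁≢v₃ e)
  spine-injective zero (suc (suc (suc zero))) e = ⊥-elim (v₁≢v₄ e)
  spine-injective (suc zero) zero e = ⊥-elim (v₁≢v₂ (sym e))
  spine-injective (suc zero) (suc zero) _ = refl
  spine-injective (suc zero) (suc (suc zero)) e = ⊥-elim (v₂≢v₃ e)
  spine-injective (suc zero) (suc (suc (suc zero))) e = ⊥-elim (v₂≢v₄ e)
  spine-injective (suc (suc zero)) zero e = ⊥-elim (v₁≢v₃ (sym e))
  spine-injective (suc (suc zero)) (suc zero) e = ⊥-elim (v₂≢v₃ (sym e))
  spine-injective (suc (suc zero)) (suc (suc zero)) _ = refl
  spine-injective (suc (suc zero)) (suc (suc (suc zero))) e = ⊥-elim (v₃≢v₄ e)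
  spine-injective (suc (suc (suc zero))) zero e = ⊥-elim (v₁≢v₄ (sym e))
  spine-injective (suc (suc (suc zero))) (suc zero) e = ⊥-elim (v₂≢v₄ (sym e))
  spine-injective (suc (suc (suc zero))) (suc (suc zero)) e = ⊥-elim (v₃≢v₄ (sym e))
  spine-injective (suc (suc (suc zero))) (suc (suc (suc zero))) _ = refl

  spine-internal : ∀ k → Internal (spine k)
  spine-internal zero                   = i₁
  spine-internal (suc zero)             = i₂
  spine-internal (suc (suc zero))       = i₃
  spine-internal (suc (suc (suc zero))) = i₄

  σ-injective : ∀ i j → σ i ≡ σ j → i ≡ j
  σ-injective = glue-injective L spine leaf-injective spine-injective
                               (λ x k → spine-internal k x)

  σ-leaves : ∀ x → σ (x ↑ˡ 4) ≡ L x
  σ-leaves x = cong [ L , spine ]′ (splitAt-↑ˡ 6 x 4)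

  is-caterpillar : Iso G T6
  is-caterpillar = Recognition.iso G T6 connected σ σ-injective σ-edges σ-closed σ-leaves

-- Concrete graphs: the conditions for being a phylogenetic tree become
-- finite, decidable checks once connectivity is witnessed by explicitly
-- found paths and acyclicity by an exhaustive search of simple paths.
module Concrete (H : LabelledGraph) where

  V : Set
  V = Fin (n H)

  A : V → V → Bool
  A = adj H

  search : ℕ → List V → (a b : V) → Maybe (Σ (List V) (Walk A a b))
  search zero    _    _ _ = nothing
  search (suc f) seen a b with a ≟ b
  ... | yes refl = just (_ , here)
  ... | no  _    = try (allFin (n H))
    where
    try : List V → Maybe (Σ (List V) (Walk A a b))
    try []       = nothing
    try (c ∷ cs) with A a c in a~c | does (DecMembership._∈?_ _≟_ c seen)
    ... | true | false with search f (a ∷ seen) c b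
    ...   | just (xs , w) = just (a ∷ xs , step a~c w)
    ...   | nothing       = try cs
    try (c ∷ cs) | _ | _ = try cs

  path-search : (a b : V) → Maybe (Σ (List V) (IsPath A a b))
  path-search a b with search (n H) [] a b
  ... | nothing     = nothing
  ... | just (xs , w) with DecUnique.unique? _≟_ xs
  ...   | yes u = just (xs , w , u)
  ...   | no  _ = nothing

  route : V → V → List V
  route a b = maybe proj₁ [] (path-search a b)

  route-path : ∀ a b → T (is-just (path-search a b)) → IsPath A a b (route a b)
  route-path a b found with path-search a b
  ... | just (_ , π) = π

  -- CycleFree f a (cur ∷ rest): the simple path a … cur (stored reversed)
  -- cannot be continued, with at most f more steps, into a cycle through a.
  CycleFree : ℕ → V → List V → Set
  CycleFree zero    _ _            = ⊥
  CycleFree (suc f) _ []           = ⊤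
  CycleFree (suc f) a (cur ∷ rest) =
    ¬ (2 ≤ length rest × A cur a ≡ true) ×
    (∀ c → A cur c ≡ true → c ∉ cur ∷ rest → CycleFree f a (c ∷ cur ∷ rest))

  cycleFree? : ∀ f a trail → Dec (CycleFree f a trail)
  cycleFree? zero    _ _            = no λ ()
  cycleFree? (suc f) _ []           = yes tt
  cycleFree? (suc f) a (cur ∷ rest) =
    ¬? ((2 ℕ.≤? length rest) ×-dec (A cur a Bool.≟ true)) ×-dec
    all? (λ c → (A cur c Bool.≟ true) →-dec
                ¬? (DecMembership._∈?_ _≟_ c (cur ∷ rest)) →-dec cycleFree? f a (c ∷ cur ∷ rest))

  cycleFree-sound : ∀ f a cur rest {b ys} → CycleFree f a (cur ∷ rest) →
                    Walk A cur b ys → Unique ys → (∀ {v} → v ∈ ys → v ∉ rest) →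
                    3 ≤ length ys + length rest → A b a ≡ true → ⊥
  cycleFree-sound (suc f) a cur rest (no-close , _) here _ _ (s≤s long) b~a = no-close (long , b~a)
  cycleFree-sound (suc f) a cur rest (_ , extend) (step {b = c} {xs = ys} cur~c w) (c∉ys ∷ u) off-rest long b~a =
    cycleFree-sound f a c (cur ∷ rest) (extend c cur~c c∉trail) w u off-trail
                    (subst (3 ≤_) (sym (+-suc (length ys) (length rest))) long) b~a
    where
    c∉trail : c ∉ cur ∷ rest
    c∉trail (here c≡cur) = Unique[x∷xs]⇒x∉xs (c∉ys ∷ u) (subst (_∈ _) c≡cur (Walks.walk-start A w))
    c∉trail (there c∈)   = off-rest (there (Walks.walk-start A w)) c∈
    off-trail : ∀ {v} → v ∈ _ → v ∉ cur ∷ rest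
    off-trail v∈ (here refl) = Unique[x∷xs]⇒x∉xs (c∉ys ∷ u) v∈
    off-trail v∈ (there v∈′) = off-rest (there v∈) v∈′

  Apart : Quartet → Set
  Apart q = Disjoint (route (leaf H (a q)) (leaf H (b q))) (route (leaf H (c q)) (leaf H (d q)))

  RoutesApart : List Quartet → Set
  RoutesApart = All Apart

  Checks : Set
  Checks = (∀ a → A a a ≡ false) × (∀ a b → A a b ≡ A b a)
         × (∀ a b → T (is-just (path-search a b))) × (∀ a → CycleFree (n H) a (a ∷ []))
         × (∀ x y → leaf H x ≡ leaf H y → x ≡ y) × (∀ x → degree A (leaf H x) ≡ 1)
         × (∀ v → degree A v ≡ 1 → ∃ λ x → leaf H x ≡ v) × (∀ v → ¬ degree A v ≡ 2)

  checks? : Dec Checks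
  checks? = all? (λ a → A a a Bool.≟ false)
     ×-dec all? (λ a → all? λ b → A a b Bool.≟ A b a)
     ×-dec all? (λ a → all? λ b → T? (is-just (path-search a b)))
     ×-dec all? (λ a → cycleFree? (n H) a (a ∷ []))
     ×-dec all? (λ x → all? λ y → (leaf H x ≟ leaf H y) →-dec (x ≟ y))
     ×-dec all? (λ x → degree A (leaf H x) ℕ.≟ 1)
     ×-dec all? (λ v → (degree A v ℕ.≟ 1) →-dec any? (λ x → leaf H x ≟ v))
     ×-dec all? (λ v → ¬? (degree A v ℕ.≟ 2))

  module _ (checks : Checks) where

    private
      irrefl : ∀ a → A a a ≡ false
      irrefl = proj₁ checks

      symm : ∀ a b → A a b ≡ A b a
      symm = proj₁ (proj₂ checks)

      found : ∀ a b → T (is-just (path-search a b))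
      found = proj₁ (proj₂ (proj₂ checks))

      cycle-free : ∀ a → CycleFree (n H) a (a ∷ [])
      cycle-free = proj₁ (proj₂ (proj₂ (proj₂ checks)))

    acyclic : Acyclic A
    acyclic xs (a , b , (w , u) , long , b~a) =
      cycleFree-sound (n H) a a [] (cycle-free a) w u (λ _ ())
                      (subst (3 ≤_) (sym (+-identityʳ _)) long) b~a

    phylo : IsPhyloTree H
    phylo = (irrefl , symm , (λ a b → route a b , route-path a b (found a b)) , acyclic)
          , proj₂ (proj₂ (proj₂ (proj₂ checks)))

    -- Displaying a quartet reduces to the disjointness of the two routes,
    -- since paths in a tree are unique.
    displays-by-routes : ∀ q → Apart q → DisplaysQ H q
    displays-by-routes q disjoint xs ys πab πcd v v∈xs v∈ys =
      disjoint (subst (v ∈_) (path-unique πab (route-path _ _ (found _ _))) v∈xs ,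
                subst (v ∈_) (path-unique πcd (route-path _ _ (found _ _))) v∈ys)
      where open Forest A irrefl symm acyclic using (path-unique)

    displays : (Q : List Quartet) → RoutesApart Q → Displays H Q
    displays Q = All.map (λ {q} → displays-by-routes q)

  displays? : (Q : List Quartet) → Dec (RoutesApart Q)
  displays? Q = All.all? (λ q → DecDisjoint.disjoint? _≟_ (route _ _) (route _ _)) Q

Cherry : LabelledGraph → Label → Label → Set
Cherry G x y = Σ (Fin (n G)) λ w → adj G w (leaf G x) ≡ true × adj G w (leaf G y) ≡ true

cherry? : ∀ G x y → Dec (Cherry G x y)
cherry? G x y = any? λ w → (adj G w (leaf G x) Bool.≟ true) ×-dec (adj G w (leaf G y) Bool.≟ true)

iso-cherry : ∀ {G H x y} → Iso G H → Cherry G x y → Cherry H x y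
iso-cherry {G} {H} {x} {y} iso (w , w~x , w~y) = to w , preserved x w~x , preserved y w~y
  where
  open Iso iso
  preserved : ∀ z → adj G w (leaf G z) ≡ true → adj H (to w) (leaf H z) ≡ true
  preserved z e = trans (cong (adj H (to w)) (sym (leaf-pres z))) (trans (adj-pres w (leaf G z)) e)

not-defining : ∀ {Q T} (H : LabelledGraph) → IsPhyloTree H → Displays H Q →
               ∀ {x y} → Cherry H x y → ¬ Cherry T x y → ¬ Defines Q T
not-defining H phylo-H displays-H cherry no-cherry (_ , _ , _ , unique) =
  no-cherry (iso-cherry (unique H phylo-H displays-H) cherry)

phylo-by-computation : ∀ H {ok : True (Concrete.checks? H)} → IsPhyloTree H
phylo-by-computation H {ok} = Concrete.phylo H (toWitness ok)

displays-by-computation : ∀ H {ok : True (Concrete.checks? H)} Q {apart : True (Concrete.displays? H Q)} → Displays H Q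
displays-by-computation H {ok} Q {apart} = Concrete.displays H (toWitness ok) Q (toWitness apart)

refuted-by : ∀ {Q T} H {ok : True (Concrete.checks? H)} {apart : True (Concrete.displays? H Q)}
             x y {cherry : True (cherry? H x y)} {no-cherry : False (cherry? T x y)} → ¬ Defines Q T
refuted-by {Q} H {ok} {apart} x y {cherry} {no-cherry} =
  not-defining H (phylo-by-computation H {ok}) (displays-by-computation H {ok} Q {apart})
               (toWitness cherry) (toWitnessFalse no-cherry)

-- Graphs on Fin 10 given by their edges; vertices 0–5 are the leaves 1–6.
from-edges : List (ℕ × ℕ) → LabelledGraph
from-edges es = record { n = 10 ; adj = λ u v → any (joins u v) es ; leaf = _↑ˡ 4 }
  where
  joins : Fin 10 → Fin 10 → ℕ × ℕ → Bool
  joins u v (x , y) = ((toℕ u ≡ᵇ x) ∧ (toℕ v ≡ᵇ y)) ∨ ((toℕ u ≡ᵇ y) ∧ (toℕ v ≡ᵇ x))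

without-12|35 without-13|46 without-12|56 without-24|56 : LabelledGraph
-- The caterpillar with leaves 2 3 | 1 | 4 | 5 6 along its spine.
without-12|35 = from-edges ((1 , 6) ∷ (2 , 6) ∷ (0 , 7) ∷ (3 , 8) ∷ (4 , 9) ∷ (5 , 9)
                          ∷ (6 , 7) ∷ (7 , 8) ∷ (8 , 9) ∷ [])
-- The caterpillar 1 4 | 2 | 5 | 3 6.
without-13|46 = from-edges ((0 , 6) ∷ (3 , 6) ∷ (1 , 7) ∷ (4 , 8) ∷ (2 , 9) ∷ (5 , 9)
                          ∷ (6 , 7) ∷ (7 , 8) ∷ (8 , 9) ∷ [])
-- The caterpillar 2 4 | 6 | 1 | 3 5.
without-12|56 = from-edges ((1 , 6) ∷ (3 , 6) ∷ (5 , 7) ∷ (0 , 8) ∷ (2 , 9) ∷ (4 , 9)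
                          ∷ (6 , 7) ∷ (7 , 8) ∷ (8 , 9) ∷ [])
-- The cherries 1 2, 3 5 and 4 6 attached to a common central vertex.
without-24|56 = from-edges ((0 , 6) ∷ (1 , 6) ∷ (6 , 7) ∷ (7 , 8) ∷ (7 , 9) ∷ (2 , 8) ∷ (4 , 8)
                          ∷ (3 , 9) ∷ (5 , 9) ∷ [])

minimal : ∀ i → ¬ Defines (removeAt Q6 i) T6
minimal zero                   = refuted-by without-12|35 l2 l3
minimal (suc zero)             = refuted-by without-13|46 l1 l4
minimal (suc (suc zero))       = refuted-by without-12|56 l2 l4
minimal (suc (suc (suc zero))) = refuted-by without-24|56 l4 l6

lemma4 : MinimallyDefinitive Q6 T6
lemma4 = (covers , phylo-by-computation T6 , displays-by-computation T6 Q6 , caterpillar) , minimal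
  where
  covers : CoversLabels Q6
  covers = toWitness {a? = all? λ x → Any.any? (λ q → DecMembership._∈?_ _≟_ x (qLabels q)) Q6} tt
  caterpillar : ∀ G → IsPhyloTree G → Displays G Q6 → Iso G T6
  caterpillar G phylo (d₁ ∷ d₂ ∷ d₃ ∷ d₄ ∷ []) = Reconstruction.is-caterpillar G phylo d₁ d₂ d₃ d₄
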